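{- Let $k',d',n'$ be positive integers with $k'<d'<n'/2$. For $m\ge1$ let $f_m=Sym_{d'm,\,n'm}$, $u_m=\dim\partial^{=k'm}f_m$ and $v_m=\mathrm{Tr}(B_m)^2/\mathrm{Tr}(B_m^2)$, where $B_m=M_m^TM_m$. Then $v_m/u_m\to0$ as $m\to\infty$.
   Context: $Sym_{d,n}(x_1,\ldots,x_n)=\sum_{I\in\{0,1\}^n,\,|I|=d}x^I$ is the elementary symmetric polynomial, where $x^I=x_1^{I_1}\cdots x_n^{I_n}$ and $|I|$ is the number of ones. $\partial^{=k} f$ is the linear space spanned by all order-$k$ partial derivatives of $f$. With $n=n'm$, $d=d'm$, $k=k'm$, $M_m$ is the matrix with rows indexed by $I\in\{0,1\}^n$ with $|I|=k$, columns by $J\in\{0,1\}^n$ with $|J|=d-k$, and $M_{I,J}=1$ if $I$ and $J$ have disjoint supports, $0$ otherwise (the coefficient of $x^J$ in $\partial_I f_m$). -}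

module Defs where

open import Data.Bool using (Bool; true; false; _∧_; not; if_then_else_)
open import Data.Nat using (ℕ; zero; suc; _+_; _*_; _∸_)
open import Data.List using (List; []; _∷_; [_]; map; _++_)
open import Data.List.Membership.Propositional using (_∈_)
open import Data.Vec using (Vec; []; _∷_)
open import Data.Fin using (Fin)
open import Data.Product using (Σ; _×_)
open import Relation.Binary.PropositionalEquality using (_≡_)
import Data.Rational as ℚ
open ℚ using (ℚ)

-- All I ∈ {0,1}^n with |I| = w (true = 1), as an explicit list
-- (each such vector occurs exactly once).
weightVecs : (n w : ℕ) → List (Vec Bool n)
weightVecs zero    zero    = [ [] ]
weightVecs zero    (suc w) = []
weightVecs (suc n) zero    = map (false ∷_) (weightVecs n zero)
weightVecs (suc n) (suc w) =
  map (true ∷_) (weightVecs n w) ++ map (false ∷_) (weightVecs n (suc w))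

disjoint : ∀ {n} → Vec Bool n → Vec Bool n → Bool
disjoint []       []       = true
disjoint (a ∷ I)  (b ∷ J)  = not (a ∧ b) ∧ disjoint I J

sumℕ : ∀ {A : Set} → List A → (A → ℕ) → ℕ
sumℕ []       f = 0
sumℕ (x ∷ xs) f = f x + sumℕ xs f

sumFinℚ : (r : ℕ) → (Fin r → ℚ) → ℚ
sumFinℚ zero    f = ℚ.0ℚ
sumFinℚ (suc r) f = f Fin.zero ℚ.+ sumFinℚ r (λ i → f (Fin.suc i))

module _ (k' d' n' m : ℕ) where
  nm dm km : ℕ
  nm = n' * m
  dm = d' * m
  km = k' * m

  Rows Cols : List (Vec Bool nm)
  Rows = weightVecs nm km
  Cols = weightVecs nm (dm ∸ km)

  M : Vec Bool nm → Vec Bool nm → ℕ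
  M I J = if disjoint I J then 1 else 0

  B : Vec Bool nm → Vec Bool nm → ℕ
  B J J' = sumℕ Rows (λ I → M I J * M I J')

  TrB : ℕ
  TrB = sumℕ Cols (λ J → B J J)

  TrB² : ℕ
  TrB² = sumℕ Cols (λ J → sumℕ Cols (λ J' → B J J' * B J' J))

  Mℚ : Vec Bool nm → Vec Bool nm → ℚ
  Mℚ I J = if disjoint I J then ℚ.1ℚ else ℚ.0ℚ

  -- u_m = dim ∂^{=k'm} f_m = dimension of the ℚ-span of the rows
  -- ∂_I f_m (coefficient vectors (M_{I,J})_J) for |I| = k.
  RowSpaceDim : ℕ → Set
  RowSpaceDim u =
    Σ (Fin u → Vec Bool nm) λ s →
      (∀ i → s i ∈ Rows) ×
      (∀ (c : Fin u → ℚ) →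
         (∀ J → J ∈ Cols → sumFinℚ u (λ i → c i ℚ.* Mℚ (s i) J) ≡ ℚ.0ℚ) →
         ∀ i → c i ≡ ℚ.0ℚ) ×
      (∀ I → I ∈ Rows →
         Σ (Fin u → ℚ) λ c →
           ∀ J → J ∈ Cols → Mℚ I J ≡ sumFinℚ u (λ i → c i ℚ.* Mℚ (s i) J))

{-# OPTIONS --safe #-}
-- Put N = n'm, K = k'm and L = d'm − k'm, so that M is the disjointness matrix
-- between the K-subsets and the L-subsets of an N-set. Every row of M has the same
-- sum b = C(N−K, L), hence Tr B = C(N,K)·b while the sum P of all entries of B is
-- C(N,K)·b²; Cauchy–Schwarz over the C(N,L)² entries of B gives P² ≤ C(N,L)²·Tr(B²),
-- and so v ≤ (C(N,L)/b)². On the other hand the K-subsets of a fixed (K+L)-set and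
-- their complements in it index an identity submatrix of M, so u ≥ C(K+L,K).
-- Finally C(K+L,K)·b² ≥ (q+1)·C(N,L)² as soon as L ≥ 4(q+1) and N ≥ 2(K+L), by
-- induction on K, which gives v/u ≤ 1/(q+1). A basis of the row space, and hence u
-- itself, is extracted by Gaussian elimination over ℚ.
module Submission where

open import Defs

open import Algebra.Bundles using (CommutativeRing)
open import Data.Bool using (Bool; true; false; _∧_; not; if_then_else_)
open import Data.Empty using (⊥-elim)
open import Data.Fin using (Fin; zero; suc; punchIn; punchOut)
open import Data.Fin.Properties using (any?; punchIn-punchOut; punchInᵢ≢i) renaming (_≟_ to _≟ᶠ_)
open import Data.List as List using (List; []; _∷_; length; allFin)
open import Data.List.Membership.Propositional using (_∈_)
open import Data.List.Membership.Propositional.Properties using (∈-map⁺; ∈-map⁻; ∈-++⁺ˡ; ∈-++⁺ʳ; ∈-++⁻; ∈-lookup; ∈-allFin)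
open import Data.List.Properties using (length-map; length-++; length-tabulate)
open import Data.List.Relation.Unary.All as All using ([])
open import Data.List.Relation.Unary.AllPairs using ([]; _∷_)
open import Data.List.Relation.Unary.Any as Any using (here; there)
open import Data.List.Relation.Unary.Any.Properties using (lookup-index)
open import Data.List.Relation.Unary.Unique.Propositional using (Unique)
import Data.List.Relation.Unary.Unique.Propositional.Properties as Unique
open import Data.Nat
open import Data.Nat.Properties
open import Algebra.Properties.CommutativeSemigroup *-commutativeSemigroup using (x∙yz≈y∙xz)
open import Data.Nat.Tactic.RingSolver using (solve-∀)
open import Data.Product using (Σ; _×_; _,_; proj₁; proj₂)
open import Data.Rational as ℚ using (ℚ; 0ℚ; 1ℚ; 1/_)
import Data.Rational.Properties as ℚP
open import Algebra.Properties.Semiring.Sum (CommutativeRing.semiring ℚP.+-*-commutativeRing) using (sum-syntax; sum-cong-≗; sum-replicate-zero; sum-remove; ∑-distrib-+; ∑-comm; *-distribˡ-sum; *-distribʳ-sum)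
open import Data.Rational.Solver using (module +-*-Solver)
open import Data.Sum using (_⊎_; inj₁; inj₂)
open import Data.Vec as Vec using (Vec; []; _∷_; replicate)
open import Data.Vec.Properties using (∷-injectiveʳ)
open import Data.Vec.Functional as Vector using (head; tail; insertAt)
open import Data.Vec.Functional.Properties using (insertAt-lookup; insertAt-punchIn)
open import Function using (_∘_)
open import Relation.Binary.PropositionalEquality
open import Relation.Nullary using (¬_; yes; no; ¬?)
open import Relation.Nullary.Decidable using (decidable-stable)

open +-*-Solver using (solve; _:+_; _:*_; :-_; _:-_; con; _:=_)

-- Sums over lists

sq : ℕ → ℕ
sq x = x * x

module _ {A : Set} where

  sumℕ-cong : ∀ (xs : List A) {f g : A → ℕ} → (∀ x → x ∈ xs → f x ≡ g x) → sumℕ xs f ≡ sumℕ xs g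
  sumℕ-cong []       f≡g = refl
  sumℕ-cong (x ∷ xs) f≡g = cong₂ _+_ (f≡g x (here refl)) (sumℕ-cong xs (λ y → f≡g y ∘ there))

  sumℕ-mono : ∀ (xs : List A) {f g : A → ℕ} → (∀ x → f x ≤ g x) → sumℕ xs f ≤ sumℕ xs g
  sumℕ-mono []       f≤g = z≤n
  sumℕ-mono (x ∷ xs) f≤g = +-mono-≤ (f≤g x) (sumℕ-mono xs f≤g)

  sumℕ-++ : ∀ (xs ys : List A) f → sumℕ (xs List.++ ys) f ≡ sumℕ xs f + sumℕ ys f
  sumℕ-++ []       ys f = refl
  sumℕ-++ (x ∷ xs) ys f = trans (cong (f x +_) (sumℕ-++ xs ys f)) (sym (+-assoc (f x) _ _))

  sumℕ-const : ∀ (xs : List A) c → sumℕ xs (λ _ → c) ≡ length xs * c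
  sumℕ-const []       c = refl
  sumℕ-const (x ∷ xs) c = cong (c +_) (sumℕ-const xs c)

  sumℕ-zero : ∀ (xs : List A) → sumℕ xs (λ _ → 0) ≡ 0
  sumℕ-zero []       = refl
  sumℕ-zero (x ∷ xs) = sumℕ-zero xs

  sumℕ-+ : ∀ (xs : List A) f g → sumℕ xs (λ x → f x + g x) ≡ sumℕ xs f + sumℕ xs g
  sumℕ-+ []       f g = refl
  sumℕ-+ (x ∷ xs) f g = trans (cong (f x + g x +_) (sumℕ-+ xs f g)) (+-exch (f x) (g x) _ _)
    where
    +-exch : ∀ a b c d → a + b + (c + d) ≡ a + c + (b + d)
    +-exch = solve-∀

  sumℕ-*ˡ : ∀ (xs : List A) c f → sumℕ xs (λ x → c * f x) ≡ c * sumℕ xs f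
  sumℕ-*ˡ []       c f = sym (*-zeroʳ c)
  sumℕ-*ˡ (x ∷ xs) c f = trans (cong (c * f x +_) (sumℕ-*ˡ xs c f)) (sym (*-distribˡ-+ c (f x) _))

  sumℕ-*ʳ : ∀ (xs : List A) c f → sumℕ xs (λ x → f x * c) ≡ sumℕ xs f * c
  sumℕ-*ʳ xs c f = trans (sumℕ-cong xs (λ x _ → *-comm (f x) c)) (trans (sumℕ-*ˡ xs c f) (*-comm c _))

module _ {A B : Set} where

  sumℕ-map : ∀ (g : A → B) (xs : List A) f → sumℕ (List.map g xs) f ≡ sumℕ xs (f ∘ g)
  sumℕ-map g []       f = refl
  sumℕ-map g (x ∷ xs) f = cong (f (g x) +_) (sumℕ-map g xs f)

  sumℕ-comm : ∀ (xs : List A) (ys : List B) (f : A → B → ℕ) →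
              sumℕ xs (λ x → sumℕ ys (f x)) ≡ sumℕ ys (λ y → sumℕ xs (λ x → f x y))
  sumℕ-comm []       ys f = sym (sumℕ-zero ys)
  sumℕ-comm (x ∷ xs) ys f = trans (cong (sumℕ ys (f x) +_) (sumℕ-comm xs ys f))
                                  (sym (sumℕ-+ ys (f x) (λ y → sumℕ xs (λ x → f x y))))

2ab≤a²+b²-ordered : ∀ {a b} → a ≤ b → 2 * (a * b) ≤ sq a + sq b
2ab≤a²+b²-ordered {a} a≤b with m≤n⇒∃[o]m+o≡n a≤b
... | t , refl = subst (2 * (a * (a + t)) ≤_) (expansion a t) (m≤m+n _ (t * t))
  where
  expansion : ∀ a t → 2 * (a * (a + t)) + t * t ≡ a * a + (a + t) * (a + t)
  expansion = solve-∀

2ab≤a²+b² : ∀ a b → 2 * (a * b) ≤ sq a + sq b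
2ab≤a²+b² a b with ≤-total a b
... | inj₁ a≤b = 2ab≤a²+b²-ordered a≤b
... | inj₂ b≤a = subst₂ _≤_ (cong (2 *_) (*-comm b a)) (+-comm (sq b) (sq a)) (2ab≤a²+b²-ordered b≤a)

sq-sumℕ≤length*sumℕ-sq : ∀ {A : Set} (xs : List A) (f : A → ℕ) →
                          sq (sumℕ xs f) ≤ length xs * sumℕ xs (sq ∘ f)
sq-sumℕ≤length*sumℕ-sq xs f = *-cancelˡ-≤ 2 (begin
  2 * sq S                                                  ≡⟨ cong (2 *_) square ⟩
  2 * sumℕ xs (λ x → sumℕ xs (λ y → f x * f y))             ≡⟨ sumℕ-*ˡ xs 2 _ ⟨
  sumℕ xs (λ x → 2 * sumℕ xs (λ y → f x * f y))             ≡⟨ sumℕ-cong xs (λ x _ → sumℕ-*ˡ xs 2 _) ⟨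
  sumℕ xs (λ x → sumℕ xs (λ y → 2 * (f x * f y)))           ≤⟨ sumℕ-mono xs (λ x → sumℕ-mono xs (λ y → 2ab≤a²+b² (f x) (f y))) ⟩
  sumℕ xs (λ x → sumℕ xs (λ y → sq (f x) + sq (f y)))       ≡⟨ sumℕ-cong xs (λ x _ → trans (sumℕ-+ xs _ (sq ∘ f)) (cong (_+ Q) (sumℕ-const xs (sq (f x))))) ⟩
  sumℕ xs (λ x → n * sq (f x) + Q)                          ≡⟨ sumℕ-+ xs _ (λ _ → Q) ⟩
  sumℕ xs (λ x → n * sq (f x)) + sumℕ xs (λ _ → Q)          ≡⟨ cong₂ _+_ (sumℕ-*ˡ xs n (sq ∘ f)) (sumℕ-const xs Q) ⟩
  n * Q + n * Q                                             ≡⟨ cong (n * Q +_) (+-identityʳ (n * Q)) ⟨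
  2 * (n * Q)                                               ∎)
  where
  open ≤-Reasoning
  S = sumℕ xs f
  Q = sumℕ xs (sq ∘ f)
  n = length xs
  square : sq S ≡ sumℕ xs (λ x → sumℕ xs (λ y → f x * f y))
  square = trans (sym (sumℕ-*ʳ xs S f)) (sumℕ-cong xs (λ x _ → sym (sumℕ-*ˡ xs (f x) f)))

sq-double-sumℕ≤ : ∀ {A : Set} (xs : List A) (g : A → A → ℕ) →
            sq (sumℕ xs (λ x → sumℕ xs (g x))) ≤ sq (length xs) * sumℕ xs (λ x → sumℕ xs (λ y → sq (g x y)))
sq-double-sumℕ≤ xs g = begin
  sq (sumℕ xs (λ x → sumℕ xs (g x)))
    ≤⟨ sq-sumℕ≤length*sumℕ-sq xs (λ x → sumℕ xs (g x)) ⟩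
  n * sumℕ xs (λ x → sq (sumℕ xs (g x)))
    ≤⟨ *-monoʳ-≤ n (sumℕ-mono xs (λ x → sq-sumℕ≤length*sumℕ-sq xs (g x))) ⟩
  n * sumℕ xs (λ x → n * sumℕ xs (λ y → sq (g x y)))
    ≡⟨ cong (n *_) (sumℕ-*ˡ xs n _) ⟩
  n * (n * sumℕ xs (λ x → sumℕ xs (λ y → sq (g x y))))
    ≡⟨ *-assoc n n _ ⟨
  sq n * sumℕ xs (λ x → sumℕ xs (λ y → sq (g x y)))  ∎
  where
  open ≤-Reasoning
  n = length xs

-- Binomial coefficients

choose : ℕ → ℕ → ℕ
choose n w = length (weightVecs n w)

choose-pascal : ∀ n w → choose (suc n) (suc w) ≡ choose n w + choose n (suc w)
choose-pascal n w = trans (length-++ (List.map (true ∷_) (weightVecs n w)))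
  (cong₂ _+_ (length-map (true ∷_) (weightVecs n w)) (length-map (false ∷_) (weightVecs n (suc w))))

choose-zero : ∀ n → choose n 0 ≡ 1
choose-zero zero    = refl
choose-zero (suc n) = trans (length-map (false ∷_) (weightVecs n 0)) (choose-zero n)

choose-one : ∀ n → choose n 1 ≡ n
choose-one zero    = refl
choose-one (suc n) = trans (choose-pascal n 0) (cong₂ _+_ (choose-zero n) (choose-one n))

choose-pos : ∀ {n w} → w ≤ n → 1 ≤ choose n w
choose-pos {n} {zero}      _         = ≤-reflexive (sym (choose-zero n))
choose-pos {suc n} {suc w} (s≤s w≤n) =
  ≤-trans (choose-pos w≤n) (subst (choose n w ≤_) (sym (choose-pascal n w)) (m≤m+n _ _))

choose-absorption : ∀ n w → suc w * choose (suc n) (suc w) ≡ suc n * choose n w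
choose-absorption zero    zero    = refl
choose-absorption zero    (suc w) = *-zeroʳ (suc (suc w))
choose-absorption (suc n) zero    = begin
  1 * choose (suc (suc n)) 1  ≡⟨ *-identityˡ _ ⟩
  choose (suc (suc n)) 1      ≡⟨ choose-one (suc (suc n)) ⟩
  suc (suc n)                 ≡⟨ *-identityʳ (suc (suc n)) ⟨
  suc (suc n) * 1             ≡⟨ cong (suc (suc n) *_) (choose-zero (suc n)) ⟨
  suc (suc n) * choose (suc n) 0 ∎
  where open ≡-Reasoning
choose-absorption (suc n) (suc w) = begin
  suc (suc w) * choose (suc (suc n)) (suc (suc w))
    ≡⟨ cong (suc (suc w) *_) (choose-pascal (suc n) (suc w)) ⟩
  suc (suc w) * (a + choose (suc n) (suc (suc w)))
    ≡⟨ *-distribˡ-+ (suc (suc w)) a _ ⟩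
  (a + suc w * a) + suc (suc w) * choose (suc n) (suc (suc w))
    ≡⟨ cong₂ (λ x y → (a + x) + y) (choose-absorption n w) (choose-absorption n (suc w)) ⟩
  (a + suc n * choose n w) + suc n * choose n (suc w)
    ≡⟨ +-assoc a _ _ ⟩
  a + (suc n * choose n w + suc n * choose n (suc w))
    ≡⟨ cong (a +_) (*-distribˡ-+ (suc n) (choose n w) _) ⟨
  a + suc n * (choose n w + choose n (suc w))
    ≡⟨ cong (λ x → a + suc n * x) (choose-pascal n w) ⟨
  suc (suc n) * a ∎
  where
  open ≡-Reasoning
  a = choose (suc n) (suc w)

choose-absorption-complement : ∀ y l → suc y * choose (suc y + l) l ≡ (suc y + l) * choose (y + l) l
choose-absorption-complement y zero = begin
  suc y * choose (suc y + 0) 0      ≡⟨ cong (suc y *_) (choose-zero (suc y + 0)) ⟩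
  suc y * 1                         ≡⟨ cong (λ k → suc k * 1) (+-identityʳ y) ⟨
  suc (y + 0) * 1                   ≡⟨ cong (suc (y + 0) *_) (choose-zero (y + 0)) ⟨
  suc (y + 0) * choose (y + 0) 0    ∎
  where open ≡-Reasoning
choose-absorption-complement y (suc l) = +-cancelʳ-≡ (suc l * c) (suc y * c) (suc n * choose n (suc l)) (begin
  suc y * c + suc l * c                       ≡⟨ *-distribʳ-+ c (suc y) (suc l) ⟨
  suc n * c                                   ≡⟨ cong (suc n *_) (choose-pascal n l) ⟩
  suc n * (choose n l + choose n (suc l))     ≡⟨ *-distribˡ-+ (suc n) (choose n l) _ ⟩
  suc n * choose n l + suc n * choose n (suc l) ≡⟨ +-comm (suc n * choose n l) _ ⟩
  suc n * choose n (suc l) + suc n * choose n l ≡⟨ cong (suc n * choose n (suc l) +_) (choose-absorption n l) ⟨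
  suc n * choose n (suc l) + suc l * c        ∎)
  where
  open ≡-Reasoning
  n = y + suc l
  c = choose (suc n) (suc l)

choose-sq-ratio : ∀ y l r s → r * sq (suc y + l) ≤ s * sq (suc y) →
                  r * sq (choose (suc y + l) l) ≤ s * sq (choose (y + l) l)
choose-sq-ratio y l r s ratio = *-cancelˡ-≤ (sq Y) (begin
  sq Y * (r * sq a)           ≡⟨ pull-sq Y r a ⟩
  r * sq (Y * a)              ≡⟨ cong (λ t → r * sq t) (choose-absorption-complement y l) ⟩
  r * sq ((Y + l) * b)        ≡⟨ pull-sq (Y + l) r b ⟨
  sq (Y + l) * (r * sq b)     ≡⟨ x∙yz≈y∙xz (sq (Y + l)) r (sq b) ⟩
  r * (sq (Y + l) * sq b)     ≡⟨ *-assoc r _ _ ⟨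
  (r * sq (Y + l)) * sq b     ≤⟨ *-monoˡ-≤ (sq b) ratio ⟩
  (s * sq Y) * sq b           ≡⟨ *-assoc s _ _ ⟩
  s * (sq Y * sq b)           ≡⟨ x∙yz≈y∙xz s (sq Y) (sq b) ⟩
  sq Y * (s * sq b)           ∎)
  where
  open ≤-Reasoning
  Y = suc y
  a = choose (Y + l) l
  b = choose (y + l) l
  pull-sq : ∀ x r z → x * x * (r * (z * z)) ≡ r * ((x * z) * (x * z))
  pull-sq = solve-∀

sq-ratio-step : ∀ j l z → j + l ≤ z → j * sq (j + z + l) ≤ (j + l) * sq (j + z)
sq-ratio-step j l z j+l≤z with m≤n⇒∃[o]m+o≡n j+l≤z
... | t , refl = subst (j * sq (j + (j + l + t) + l) ≤_) (sym (expansion j l t)) (m≤m+n _ _)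
  where
  expansion : ∀ j l t → (j + l) * ((j + (j + l + t)) * (j + (j + l + t))) ≡
              j * ((j + (j + l + t) + l) * (j + (j + l + t) + l)) + l * (j * l + 2 * j * t + (l + t) * (l + t))
  expansion = solve-∀

sq-ratio-base : ∀ q l z → 4 * suc q ≤ l → l ≤ z → suc q * sq (suc z + l) ≤ suc l * sq (suc z)
sq-ratio-base q l z 4[q+1]≤l l≤z = begin
  suc q * sq (Y + l)          ≤⟨ *-monoʳ-≤ (suc q) (*-mono-≤ Y+l≤2Y Y+l≤2Y) ⟩
  suc q * sq (2 * Y)          ≡⟨ expansion (suc q) Y ⟩
  (4 * suc q) * sq Y          ≤⟨ *-monoˡ-≤ (sq Y) (m≤n⇒m≤1+n 4[q+1]≤l) ⟩
  suc l * sq Y                ∎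
  where
  open ≤-Reasoning
  Y = suc z
  Y+l≤2Y : Y + l ≤ 2 * Y
  Y+l≤2Y = subst (Y + l ≤_) (cong (Y +_) (sym (+-identityʳ Y))) (+-monoʳ-≤ Y (m≤n⇒m≤1+n l≤z))
  expansion : ∀ q Y → q * ((2 * Y) * (2 * Y)) ≡ (4 * q) * (Y * Y)
  expansion = solve-∀

-- Induction on K = k+1: going from K to K+1 multiplies C(K+l, K) by (K+1+l)/(K+1)
-- (absorption) and C(K+z+l, l)² by at most that much (sq-ratio-step, which needs
-- K+1+l ≤ z); the base case K = 1 is where l ≥ 4(q+1) enters.
choose-sq-bound : ∀ q l z k → 4 * suc q ≤ l → suc k + l ≤ z →
  suc q * sq (choose (suc k + z + l) l) ≤ choose (suc k + l) (suc k) * sq (choose (z + l) l)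
choose-sq-bound q l z zero 4[q+1]≤l 1+l≤z =
  subst (λ c → suc q * sq (choose (suc z + l) l) ≤ c * sq (choose (z + l) l)) (sym (choose-one (suc l)))
        (choose-sq-ratio z l (suc q) (suc l) (sq-ratio-base q l z 4[q+1]≤l (≤-trans (n≤1+n l) 1+l≤z)))
choose-sq-bound q l z (suc k) 4[q+1]≤l j+l≤z = *-cancelˡ-≤ j (begin
  j * (suc q * sq a)                ≡⟨ x∙yz≈y∙xz j (suc q) (sq a) ⟩
  suc q * (j * sq a)                ≤⟨ *-monoʳ-≤ (suc q) (choose-sq-ratio (suc k + z) l j (j + l) (sq-ratio-step j l z j+l≤z)) ⟩
  suc q * ((j + l) * sq b)          ≡⟨ x∙yz≈y∙xz (suc q) (j + l) (sq b) ⟩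
  (j + l) * (suc q * sq b)          ≤⟨ *-monoʳ-≤ (j + l) (choose-sq-bound q l z k 4[q+1]≤l (≤-trans (n≤1+n _) j+l≤z)) ⟩
  (j + l) * (c * sq d)              ≡⟨ *-assoc (j + l) c (sq d) ⟨
  ((j + l) * c) * sq d              ≡⟨ cong (_* sq d) (choose-absorption (suc k + l) (suc k)) ⟨
  (j * choose (j + l) j) * sq d     ≡⟨ *-assoc j (choose (j + l) j) (sq d) ⟩
  j * (choose (j + l) j * sq d)     ∎)
  where
  open ≤-Reasoning
  j = suc (suc k)
  a = choose (j + z + l) l
  b = choose (suc k + z + l) l
  c = choose (suc k + l) (suc k)
  d = choose (z + l) l

choose-sq-bound′ : ∀ q N K L → 1 ≤ K → 4 * suc q ≤ L → 2 * (K + L) ≤ N →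
                   suc q * sq (choose N L) ≤ choose (K + L) K * sq (choose (N ∸ K) L)
choose-sq-bound′ q N (suc k) L _ 4[q+1]≤L 2[K+L]≤N with m≤n⇒∃[o]m+o≡n (≤-trans (m≤m+n (suc k + L) _) 2[K+L]≤N)
... | z , refl = subst₂ (λ n n∸K → suc q * sq (choose n L) ≤ choose (suc k + L) (suc k) * sq (choose n∸K L))
                        (rearrange k L z) (rearrange-∸ k L z)
                        (choose-sq-bound q L z k 4[q+1]≤L K+L≤z)
  where
  K+L≤z : suc k + L ≤ z
  K+L≤z = +-cancelˡ-≤ (suc k + L) _ _ (subst (_≤ suc k + L + z) (cong (suc k + L +_) (+-identityʳ (suc k + L))) 2[K+L]≤N)
  rearrange : ∀ k L z → suc k + z + L ≡ suc k + L + z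
  rearrange = solve-∀
  rearrange-∸ : ∀ k L z → z + L ≡ suc k + L + z ∸ suc k
  rearrange-∸ k L z = trans (+-comm z L) (sym (trans (cong (_∸ suc k) (+-assoc (suc k) L z)) (m+n∸m≡n (suc k) (L + z))))

-- Boolean vectors of fixed weight

ones zeros : ∀ {n} → Vec Bool n → ℕ
ones []          = 0
ones (true ∷ I)  = suc (ones I)
ones (false ∷ I) = ones I
zeros []          = 0
zeros (true ∷ I)  = zeros I
zeros (false ∷ I) = suc (zeros I)

zeros+ones : ∀ {n} (I : Vec Bool n) → zeros I + ones I ≡ n
zeros+ones []          = refl
zeros+ones (true ∷ I)  = trans (+-suc (zeros I) (ones I)) (cong suc (zeros+ones I))
zeros+ones (false ∷ I) = cong suc (zeros+ones I)

∈weightVecs⇒ones≡ : ∀ {n w} {I : Vec Bool n} → I ∈ weightVecs n w → ones I ≡ w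
∈weightVecs⇒ones≡ {zero}  {zero}  (here refl) = refl
∈weightVecs⇒ones≡ {suc n} {zero}  I∈ with ∈-map⁻ (false ∷_) I∈
... | _ , I′∈ , refl = ∈weightVecs⇒ones≡ I′∈
∈weightVecs⇒ones≡ {suc n} {suc w} I∈ with ∈-++⁻ (List.map (true ∷_) (weightVecs n w)) I∈
... | inj₁ I∈₁ with ∈-map⁻ (true ∷_) I∈₁
...   | _ , I′∈ , refl = cong suc (∈weightVecs⇒ones≡ I′∈)
∈weightVecs⇒ones≡ {suc n} {suc w} I∈ | inj₂ I∈₂ with ∈-map⁻ (false ∷_) I∈₂
...   | _ , I′∈ , refl = ∈weightVecs⇒ones≡ I′∈

∈weightVecs-ones : ∀ {n} (I : Vec Bool n) → I ∈ weightVecs n (ones I)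
∈weightVecs-ones []          = here refl
∈weightVecs-ones (true ∷ I)  = ∈-++⁺ˡ (∈-map⁺ (true ∷_) (∈weightVecs-ones I))
∈weightVecs-ones {suc n} (false ∷ I) with ones I | ∈weightVecs-ones I
... | zero  | I∈ = ∈-map⁺ (false ∷_) I∈
... | suc w | I∈ = ∈-++⁺ʳ (List.map (true ∷_) (weightVecs n w)) (∈-map⁺ (false ∷_) I∈)

ones≡⇒∈weightVecs : ∀ {n w} {I : Vec Bool n} → ones I ≡ w → I ∈ weightVecs n w
ones≡⇒∈weightVecs {I = I} refl = ∈weightVecs-ones I

∈weightVecs⇒zeros≡ : ∀ {n w} {I : Vec Bool n} → I ∈ weightVecs n w → zeros I ≡ n ∸ w
∈weightVecs⇒zeros≡ {n} {w} {I} I∈ = begin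
  zeros I               ≡⟨ m+n∸n≡m (zeros I) w ⟨
  zeros I + w ∸ w       ≡⟨ cong (λ k → zeros I + k ∸ w) (∈weightVecs⇒ones≡ I∈) ⟨
  zeros I + ones I ∸ w  ≡⟨ cong (_∸ w) (zeros+ones I) ⟩
  n ∸ w                 ∎
  where open ≡-Reasoning

weightVecs-unique : ∀ n w → Unique (weightVecs n w)
weightVecs-unique zero    zero    = [] ∷ []
weightVecs-unique zero    (suc w) = []
weightVecs-unique (suc n) zero    = Unique.map⁺ ∷-injectiveʳ (weightVecs-unique n zero)
weightVecs-unique (suc n) (suc w) =
  Unique.++⁺ (Unique.map⁺ ∷-injectiveʳ (weightVecs-unique n w))
             (Unique.map⁺ ∷-injectiveʳ (weightVecs-unique n (suc w))) heads-differ
  where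
  heads-differ : ∀ {I} → ¬ (I ∈ List.map (true ∷_) (weightVecs n w) × I ∈ List.map (false ∷_) (weightVecs n (suc w)))
  heads-differ (I∈₁ , I∈₂) with ∈-map⁻ (true ∷_) I∈₁ | ∈-map⁻ (false ∷_) I∈₂
  ... | _ , _ , refl | _ , _ , ()

lookup-injective : ∀ {A : Set} {xs : List A} → Unique xs → ∀ i j → List.lookup xs i ≡ List.lookup xs j → i ≡ j
lookup-injective (_ ∷ _)    Fin.zero    Fin.zero    _  = refl
lookup-injective (x∉ ∷ _)   Fin.zero    (Fin.suc j) eq = ⊥-elim (All.lookup x∉ (∈-lookup j) eq)
lookup-injective (x∉ ∷ _)   (Fin.suc i) Fin.zero    eq = ⊥-elim (All.lookup x∉ (∈-lookup i) (sym eq))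
lookup-injective (_ ∷ uniq) (Fin.suc i) (Fin.suc j) eq = cong Fin.suc (lookup-injective uniq i j eq)

sumℕ-weightVecs-suc : ∀ n w (f : Vec Bool (suc n) → ℕ) →
  sumℕ (weightVecs (suc n) (suc w)) f ≡ sumℕ (weightVecs n w) (f ∘ (true ∷_)) + sumℕ (weightVecs n (suc w)) (f ∘ (false ∷_))
sumℕ-weightVecs-suc n w f =
  trans (sumℕ-++ (List.map (true ∷_) (weightVecs n w)) _ f)
        (cong₂ _+_ (sumℕ-map (true ∷_) (weightVecs n w) f) (sumℕ-map (false ∷_) (weightVecs n (suc w)) f))

indicator : Bool → ℕ
indicator b = if b then 1 else 0

count-disjoint : ∀ {n} (I : Vec Bool n) L → sumℕ (weightVecs n L) (indicator ∘ disjoint I) ≡ choose (zeros I) L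
count-disjoint []                  zero    = refl
count-disjoint []                  (suc L) = refl
count-disjoint {suc n} (true ∷ I)  zero    =
  trans (sumℕ-map (false ∷_) (weightVecs n 0) _) (count-disjoint I zero)
count-disjoint {suc n} (false ∷ I) zero    =
  trans (sumℕ-map (false ∷_) (weightVecs n 0) _)
        (trans (count-disjoint I zero) (trans (choose-zero (zeros I)) (sym (choose-zero (suc (zeros I))))))
count-disjoint {suc n} (true ∷ I)  (suc L) =
  trans (sumℕ-weightVecs-suc n L _) (cong₂ _+_ (sumℕ-zero (weightVecs n L)) (count-disjoint I (suc L)))
count-disjoint {suc n} (false ∷ I) (suc L) =
  trans (sumℕ-weightVecs-suc n L _)
        (trans (cong₂ _+_ (count-disjoint I L) (count-disjoint I (suc L))) (sym (choose-pascal (zeros I) L)))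

pad : ∀ {D N} → D ≤ N → Vec Bool D → Vec Bool N
pad {N = N} z≤n       []      = replicate N false
pad         (s≤s D≤N) (b ∷ I) = b ∷ pad D≤N I

ones-pad : ∀ {D N} (D≤N : D ≤ N) (I : Vec Bool D) → ones (pad D≤N I) ≡ ones I
ones-pad {N = N} z≤n [] = ones-replicate N
  where
  ones-replicate : ∀ N → ones (replicate N false) ≡ 0
  ones-replicate zero    = refl
  ones-replicate (suc N) = ones-replicate N
ones-pad (s≤s D≤N) (true ∷ I)  = cong suc (ones-pad D≤N I)
ones-pad (s≤s D≤N) (false ∷ I) = ones-pad D≤N I

disjoint-pad : ∀ {D N} (D≤N : D ≤ N) (I J : Vec Bool D) → disjoint (pad D≤N I) (pad D≤N J) ≡ disjoint I J
disjoint-pad {N = N} z≤n [] [] = disjoint-replicate N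
  where
  disjoint-replicate : ∀ N → disjoint (replicate N false) (replicate N false) ≡ true
  disjoint-replicate zero    = refl
  disjoint-replicate (suc N) = disjoint-replicate N
disjoint-pad (s≤s D≤N) (a ∷ I) (b ∷ J) = cong (not (a ∧ b) ∧_) (disjoint-pad D≤N I J)

ones-complement : ∀ {n} (I : Vec Bool n) → ones (Vec.map not I) ≡ zeros I
ones-complement []          = refl
ones-complement (true ∷ I)  = ones-complement I
ones-complement (false ∷ I) = cong suc (ones-complement I)

disjoint-complement : ∀ {n} (I : Vec Bool n) → disjoint I (Vec.map not I) ≡ true
disjoint-complement []          = refl
disjoint-complement (true ∷ I)  = disjoint-complement I
disjoint-complement (false ∷ I) = disjoint-complement I

disjoint-complement⇒ones≤ : ∀ {n} (I I′ : Vec Bool n) → disjoint I (Vec.map not I′) ≡ true → ones I ≤ ones I′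
disjoint-complement⇒ones≤ []          []           _  = z≤n
disjoint-complement⇒ones≤ (true ∷ I)  (true ∷ I′)  d  = s≤s (disjoint-complement⇒ones≤ I I′ d)
disjoint-complement⇒ones≤ (false ∷ I) (true ∷ I′)  d  = m≤n⇒m≤1+n (disjoint-complement⇒ones≤ I I′ d)
disjoint-complement⇒ones≤ (false ∷ I) (false ∷ I′) d  = disjoint-complement⇒ones≤ I I′ d

disjoint-complement⇒≡ : ∀ {n} (I I′ : Vec Bool n) → disjoint I (Vec.map not I′) ≡ true → ones I ≡ ones I′ → I ≡ I′
disjoint-complement⇒≡ []          []           _ _  = refl
disjoint-complement⇒≡ (true ∷ I)  (true ∷ I′)  d eq = cong (true ∷_) (disjoint-complement⇒≡ I I′ d (suc-injective eq))
disjoint-complement⇒≡ (false ∷ I) (true ∷ I′)  d eq =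
  ⊥-elim (1+n≰n (subst (_≤ ones I′) eq (disjoint-complement⇒ones≤ I I′ d)))
disjoint-complement⇒≡ (false ∷ I) (false ∷ I′) d eq = cong (false ∷_) (disjoint-complement⇒≡ I I′ d eq)

module IdentitySubmatrix {K L N : ℕ} (K+L≤N : K + L ≤ N) where

  private
    W = weightVecs (K + L) K
    W∈ : ∀ a → List.lookup W a ∈ W
    W∈ = ∈-lookup

  row col : Fin (choose (K + L) K) → Vec Bool N
  row a = pad K+L≤N (List.lookup W a)
  col a = pad K+L≤N (Vec.map not (List.lookup W a))

  row∈ : ∀ a → row a ∈ weightVecs N K
  row∈ a = ones≡⇒∈weightVecs (trans (ones-pad K+L≤N _) (∈weightVecs⇒ones≡ (W∈ a)))

  col∈ : ∀ a → col a ∈ weightVecs N L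
  col∈ a = ones≡⇒∈weightVecs (begin
    ones (col a)                             ≡⟨ ones-pad K+L≤N _ ⟩
    ones (Vec.map not (List.lookup W a))     ≡⟨ ones-complement (List.lookup W a) ⟩
    zeros (List.lookup W a)                  ≡⟨ ∈weightVecs⇒zeros≡ (W∈ a) ⟩
    K + L ∸ K                                ≡⟨ m+n∸m≡n K L ⟩
    L                                        ∎)
    where open ≡-Reasoning

  disjoint-row-col : ∀ a → disjoint (row a) (col a) ≡ true
  disjoint-row-col a = trans (disjoint-pad K+L≤N _ _) (disjoint-complement (List.lookup W a))

  disjoint-row-col⇒≡ : ∀ a b → disjoint (row a) (col b) ≡ true → a ≡ b
  disjoint-row-col⇒≡ a b d = lookup-injective (weightVecs-unique (K + L) K) a b
    (disjoint-complement⇒≡ _ _ (trans (sym (disjoint-pad K+L≤N _ _)) d)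
                           (trans (∈weightVecs⇒ones≡ (W∈ a)) (sym (∈weightVecs⇒ones≡ (W∈ b)))))

-- Linear algebra over ℚ

sumFinℚ≡∑ : ∀ r (f : Fin r → ℚ) → sumFinℚ r f ≡ ∑[ i < r ] f i
sumFinℚ≡∑ zero    f = refl
sumFinℚ≡∑ (suc r) f = cong (f zero ℚ.+_) (sumFinℚ≡∑ r (f ∘ suc))

p*q≡0⇒p≡0 : ∀ p {q} → q ≢ 0ℚ → p ℚ.* q ≡ 0ℚ → p ≡ 0ℚ
p*q≡0⇒p≡0 p {q} q≢0 pq≡0 = begin
  p                     ≡⟨ solve 1 (λ x → x := x :* con 1ℚ) refl p ⟩
  p ℚ.* 1ℚ              ≡⟨ cong (p ℚ.*_) (ℚP.*-inverseʳ q) ⟨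
  p ℚ.* (q ℚ.* 1/ q)    ≡⟨ ℚP.*-assoc p q (1/ q) ⟨
  (p ℚ.* q) ℚ.* 1/ q    ≡⟨ cong (ℚ._* 1/ q) pq≡0 ⟩
  0ℚ ℚ.* 1/ q           ≡⟨ ℚP.*-zeroˡ (1/ q) ⟩
  0ℚ                    ∎
  where
  open ≡-Reasoning
  instance _ = ℚ.≢-nonZero q≢0

module _ {A : Set} where

  lincomb : ∀ {u} → (Fin u → ℚ) → (Fin u → A → ℚ) → A → ℚ
  lincomb {u} c v J = ∑[ i < u ] (c i ℚ.* v i J)

  Independent : List A → ∀ {u} → (Fin u → A → ℚ) → Set
  Independent cols v = ∀ c → (∀ J → J ∈ cols → lincomb c v J ≡ 0ℚ) → ∀ i → c i ≡ 0ℚ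

  InSpan : List A → ∀ {u} → (Fin u → A → ℚ) → (A → ℚ) → Set
  InSpan cols {u} v w = Σ (Fin u → ℚ) λ c → ∀ J → J ∈ cols → w J ≡ lincomb c v J

  record Subbasis (cols : List A) {p} (w : Fin p → A → ℚ) : Set where
    field
      size        : ℕ
      select      : Fin size → Fin p
      independent : Independent cols (w ∘ select)
      spanning    : ∀ j → InSpan cols (w ∘ select) (w j)

  lincomb-zeroʳ : ∀ {u} (c : Fin u → ℚ) (v : Fin u → A → ℚ) J →
                  (∀ i → v i J ≡ 0ℚ) → lincomb c v J ≡ 0ℚ
  lincomb-zeroʳ {u} c v J v≡0 =
    trans (sum-cong-≗ (λ i → trans (cong (c i ℚ.*_) (v≡0 i)) (ℚP.*-zeroʳ (c i))))
          (sum-replicate-zero u)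

  lincomb-zeroˡ : ∀ {u} (c : Fin u → ℚ) (v : Fin u → A → ℚ) J →
                  (∀ i → c i ≡ 0ℚ) → lincomb c v J ≡ 0ℚ
  lincomb-zeroˡ {u} c v J c≡0 =
    trans (sum-cong-≗ (λ i → trans (cong (ℚ._* v i J) (c≡0 i)) (ℚP.*-zeroˡ (v i J))))
          (sum-replicate-zero u)

  zero-column-or-pivot : ∀ {p} (w : Fin p → A → ℚ) x →
                         (∀ i → w i x ≡ 0ℚ) ⊎ Σ (Fin p) λ π → w π x ≢ 0ℚ
  zero-column-or-pivot w x with any? (λ i → ¬? (w i x ℚ.≟ 0ℚ))
  ... | yes pivot = inj₂ pivot
  ... | no ¬pivot = inj₁ (λ i → decidable-stable (w i x ℚ.≟ 0ℚ) (¬pivot ∘ (i ,_)))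

  Independent-∷ : ∀ {x cs u} {v : Fin u → A → ℚ} → Independent cs v → Independent (x ∷ cs) v
  Independent-∷ ind c vanish = ind c (λ J J∈cs → vanish J (there J∈cs))

  Independent-∷⁻ : ∀ {x cs u} {v : Fin u → A → ℚ} → (∀ i → v i x ≡ 0ℚ) →
                   Independent (x ∷ cs) v → Independent cs v
  Independent-∷⁻ {v = v} v[x]≡0 ind c vanish = ind c λ
    { J (here refl)    → lincomb-zeroʳ c v J v[x]≡0
    ; J (there J∈cs)   → vanish J J∈cs }

  InSpan-∷ : ∀ {x cs u} {v : Fin u → A → ℚ} {w} → (∀ i → v i x ≡ 0ℚ) → w x ≡ 0ℚ →
             InSpan cs v w → InSpan (x ∷ cs) v w
  InSpan-∷ {v = v} v[x]≡0 w[x]≡0 (c , w≡) = c , λ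
    { J (here refl)  → trans w[x]≡0 (sym (lincomb-zeroʳ c v J v[x]≡0))
    ; J (there J∈cs) → w≡ J J∈cs }

  -- Gaussian elimination step: subtracting multiples of the pivot row π clears
  -- the column x in all other rows.
  module Pivot {p} (w : Fin (suc p) → A → ℚ) (π : Fin (suc p)) (x : A) (w[π]x≢0 : w π x ≢ 0ℚ) where

    private instance _ = ℚ.≢-nonZero w[π]x≢0

    ratio : Fin p → ℚ
    ratio j = w (punchIn π j) x ℚ.* 1/ (w π x)

    reduced : Fin p → A → ℚ
    reduced j J = w (punchIn π j) J ℚ.- ratio j ℚ.* w π J

    reduced-vanishes : ∀ j → reduced j x ≡ 0ℚ
    reduced-vanishes j = begin
      a ℚ.- (a ℚ.* 1/ (w π x)) ℚ.* w π x  ≡⟨ cong (λ t → a ℚ.- t) (ℚP.*-assoc a _ _) ⟩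
      a ℚ.- a ℚ.* (1/ (w π x) ℚ.* w π x)  ≡⟨ cong (λ t → a ℚ.- a ℚ.* t) (ℚP.*-inverseˡ (w π x)) ⟩
      a ℚ.- a ℚ.* 1ℚ                       ≡⟨ solve 1 (λ a → a :- a :* con 1ℚ := con 0ℚ) refl a ⟩
      0ℚ                                   ∎
      where
      open ≡-Reasoning
      a = w (punchIn π j) x

    reduced-decomposition : ∀ j J → w (punchIn π j) J ≡ reduced j J ℚ.+ ratio j ℚ.* w π J
    reduced-decomposition j J =
      solve 2 (λ a b → a := (a :- b) :+ b) refl (w (punchIn π j) J) (ratio j ℚ.* w π J)

    lincomb-punchIn : ∀ {u} (c : Fin u → ℚ) (τ : Fin u → Fin p) J →
      lincomb c (w ∘ punchIn π ∘ τ) J ≡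
      lincomb c (reduced ∘ τ) J ℚ.+ (∑[ i < u ] (c i ℚ.* ratio (τ i))) ℚ.* w π J
    lincomb-punchIn {u} c τ J = begin
      lincomb c (w ∘ punchIn π ∘ τ) J
        ≡⟨ sum-cong-≗ (λ i → trans (cong (c i ℚ.*_) (reduced-decomposition (τ i) J))
                                   (distrib (c i) (reduced (τ i) J) (ratio (τ i)))) ⟩
      ∑[ i < u ] (c i ℚ.* reduced (τ i) J ℚ.+ c i ℚ.* ratio (τ i) ℚ.* w π J)
        ≡⟨ ∑-distrib-+ (λ i → c i ℚ.* reduced (τ i) J) (λ i → c i ℚ.* ratio (τ i) ℚ.* w π J) ⟩
      lincomb c (reduced ∘ τ) J ℚ.+ ∑[ i < u ] (c i ℚ.* ratio (τ i) ℚ.* w π J)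
        ≡⟨ cong (lincomb c (reduced ∘ τ) J ℚ.+_) (*-distribʳ-sum (w π J) (λ i → c i ℚ.* ratio (τ i))) ⟨
      lincomb c (reduced ∘ τ) J ℚ.+ (∑[ i < u ] (c i ℚ.* ratio (τ i))) ℚ.* w π J
        ∎
      where
      open ≡-Reasoning
      distrib : ∀ a r b → a ℚ.* (r ℚ.+ b ℚ.* w π J) ≡ a ℚ.* r ℚ.+ a ℚ.* b ℚ.* w π J
      distrib a r b = solve 4 (λ a r b v → a :* (r :+ b :* v) := a :* r :+ a :* b :* v) refl a r b (w π J)

    independent-reduced : ∀ {cs} → Independent (x ∷ cs) w → Independent cs reduced
    independent-reduced {cs} ind c vanish j =
      trans (sym (insertAt-punchIn c π (ℚ.- β) j)) (ind c* vanish* (punchIn π j))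
      where
      open ≡-Reasoning
      β = ∑[ i < p ] (c i ℚ.* ratio i)
      c* = insertAt c π (ℚ.- β)
      lincomb-c* : ∀ J → lincomb c* w J ≡ lincomb c reduced J
      lincomb-c* J = begin
        lincomb c* w J
          ≡⟨ sum-remove {i = π} (λ i → c* i ℚ.* w i J) ⟩
        c* π ℚ.* w π J ℚ.+ lincomb (c* ∘ punchIn π) (w ∘ punchIn π) J
          ≡⟨ cong₂ (λ a b → a ℚ.* w π J ℚ.+ b) (insertAt-lookup c π (ℚ.- β))
                   (sum-cong-≗ (λ i → cong (ℚ._* w (punchIn π i) J) (insertAt-punchIn c π (ℚ.- β) i))) ⟩
        ℚ.- β ℚ.* w π J ℚ.+ lincomb c (w ∘ punchIn π) J
          ≡⟨ cong (ℚ.- β ℚ.* w π J ℚ.+_) (lincomb-punchIn c (λ i → i) J) ⟩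
        ℚ.- β ℚ.* w π J ℚ.+ (lincomb c reduced J ℚ.+ β ℚ.* w π J)
          ≡⟨ solve 3 (λ b v s → :- b :* v :+ (s :+ b :* v) := s) refl β (w π J) (lincomb c reduced J) ⟩
        lincomb c reduced J
          ∎
      vanish* : ∀ J → J ∈ x ∷ cs → lincomb c* w J ≡ 0ℚ
      vanish* J (here refl)  = trans (lincomb-c* J) (lincomb-zeroʳ c reduced J reduced-vanishes)
      vanish* J (there J∈cs) = trans (lincomb-c* J) (vanish J J∈cs)

    extend : ∀ {u} → (Fin u → Fin p) → Fin (suc u) → Fin (suc p)
    extend τ = π Vector.∷ punchIn π ∘ τ

    lincomb-extend : ∀ {u} (c : Fin (suc u) → ℚ) (τ : Fin u → Fin p) J →
      lincomb c (w ∘ extend τ) J ≡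
      (head c ℚ.+ ∑[ i < u ] (tail c i ℚ.* ratio (τ i))) ℚ.* w π J ℚ.+ lincomb (tail c) (reduced ∘ τ) J
    lincomb-extend c τ J =
      trans (cong (head c ℚ.* w π J ℚ.+_) (lincomb-punchIn (tail c) τ J))
            (solve 4 (λ a v s b → a :* v :+ (s :+ b :* v) := (a :+ b) :* v :+ s) refl
                   (head c) (w π J) (lincomb (tail c) (reduced ∘ τ) J) _)

    independent-extend : ∀ {cs u} (τ : Fin u → Fin p) →
                         Independent cs (reduced ∘ τ) → Independent (x ∷ cs) (w ∘ extend τ)
    independent-extend {cs} {u} τ ind c vanish = λ { zero → head≡0 ; (suc i) → tail≡0 i }
      where
      open ≡-Reasoning
      β = ∑[ i < u ] (tail c i ℚ.* ratio (τ i))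
      rest = lincomb (tail c) (reduced ∘ τ)

      head+β≡0 : head c ℚ.+ β ≡ 0ℚ
      head+β≡0 = p*q≡0⇒p≡0 _ w[π]x≢0 (begin
        (head c ℚ.+ β) ℚ.* w π x            ≡⟨ solve 1 (λ t → t := t :+ con 0ℚ) refl _ ⟩
        (head c ℚ.+ β) ℚ.* w π x ℚ.+ 0ℚ     ≡⟨ cong ((head c ℚ.+ β) ℚ.* w π x ℚ.+_) (lincomb-zeroʳ (tail c) (reduced ∘ τ) x (reduced-vanishes ∘ τ)) ⟨
        (head c ℚ.+ β) ℚ.* w π x ℚ.+ rest x ≡⟨ lincomb-extend c τ x ⟨
        lincomb c (w ∘ extend τ) x           ≡⟨ vanish x (here refl) ⟩
        0ℚ                                   ∎)

      tail≡0 : ∀ i → tail c i ≡ 0ℚ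
      tail≡0 = ind (tail c) λ J J∈cs → begin
        rest J                                ≡⟨ solve 2 (λ s v → s := con 0ℚ :* v :+ s) refl (rest J) (w π J) ⟩
        0ℚ ℚ.* w π J ℚ.+ rest J               ≡⟨ cong (λ t → t ℚ.* w π J ℚ.+ rest J) head+β≡0 ⟨
        (head c ℚ.+ β) ℚ.* w π J ℚ.+ rest J   ≡⟨ lincomb-extend c τ J ⟨
        lincomb c (w ∘ extend τ) J            ≡⟨ vanish J (there J∈cs) ⟩
        0ℚ                                    ∎

      head≡0 : head c ≡ 0ℚ
      head≡0 = begin
        head c             ≡⟨ solve 1 (λ t → t := t :+ con 0ℚ) refl (head c) ⟩
        head c ℚ.+ 0ℚ      ≡⟨ cong (head c ℚ.+_) (lincomb-zeroˡ (tail c) (λ i _ → ratio (τ i)) x tail≡0) ⟨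
        head c ℚ.+ β       ≡⟨ head+β≡0 ⟩
        0ℚ                 ∎

    spanning-extend : ∀ {cs u} (τ : Fin u → Fin p) →
                      (∀ j → InSpan cs (reduced ∘ τ) (reduced j)) →
                      ∀ j → InSpan (x ∷ cs) (w ∘ extend τ) (w j)
    spanning-extend {cs} {u} τ span j with j ≟ᶠ π
    ... | yes refl = (1ℚ Vector.∷ λ _ → 0ℚ) , λ J _ → begin
      w π J                                    ≡⟨ solve 1 (λ t → t := con 1ℚ :* t :+ con 0ℚ) refl (w π J) ⟩
      1ℚ ℚ.* w π J ℚ.+ 0ℚ                      ≡⟨ cong (1ℚ ℚ.* w π J ℚ.+_) (lincomb-zeroˡ (λ _ → 0ℚ) (w ∘ punchIn π ∘ τ) J (λ _ → refl)) ⟨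
      lincomb (1ℚ Vector.∷ λ _ → 0ℚ) (w ∘ extend τ) J ∎
      where open ≡-Reasoning
    ... | no j≢π = (ratio j′ ℚ.- β Vector.∷ e) , w[j]≡
      where
      open ≡-Reasoning
      π≢j = j≢π ∘ sym
      j′ = punchOut π≢j
      e = proj₁ (span j′)
      e-spans : ∀ J → J ∈ x ∷ cs → reduced j′ J ≡ lincomb e (reduced ∘ τ) J
      e-spans = proj₂ (InSpan-∷ (reduced-vanishes ∘ τ) (reduced-vanishes j′) (span j′))
      β = ∑[ i < u ] (e i ℚ.* ratio (τ i))
      w[j]≡ : ∀ J → J ∈ x ∷ cs → w j J ≡ lincomb (ratio j′ ℚ.- β Vector.∷ e) (w ∘ extend τ) J
      w[j]≡ J J∈ = begin
        w j J                                                   ≡⟨ cong (λ i → w i J) (punchIn-punchOut π≢j) ⟨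
        w (punchIn π j′) J                                      ≡⟨ reduced-decomposition j′ J ⟩
        reduced j′ J ℚ.+ ratio j′ ℚ.* w π J                     ≡⟨ cong (ℚ._+ ratio j′ ℚ.* w π J) (e-spans J J∈) ⟩
        lincomb e (reduced ∘ τ) J ℚ.+ ratio j′ ℚ.* w π J
          ≡⟨ solve 4 (λ s a b v → s :+ a :* v := (a :- b :+ b) :* v :+ s) refl
                   (lincomb e (reduced ∘ τ) J) (ratio j′) β (w π J) ⟩
        (ratio j′ ℚ.- β ℚ.+ β) ℚ.* w π J ℚ.+ lincomb e (reduced ∘ τ) J
          ≡⟨ lincomb-extend (ratio j′ ℚ.- β Vector.∷ e) τ J ⟨
        lincomb (ratio j′ ℚ.- β Vector.∷ e) (w ∘ extend τ) J    ∎

    subbasis-extend : ∀ {cs} → Subbasis cs reduced → Subbasis (x ∷ cs) w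
    subbasis-extend sb = record
      { size        = suc size
      ; select      = extend select
      ; independent = independent-extend select independent
      ; spanning    = spanning-extend select spanning
      }
      where open Subbasis sb

  subbasis : ∀ cols {p} (w : Fin p → A → ℚ) → Subbasis cols w
  subbasis [] w = record
    { size = 0 ; select = λ () ; independent = λ _ _ () ; spanning = λ _ → (λ ()) , λ _ () }
  subbasis (x ∷ cs) {p} w with zero-column-or-pivot w x
  ... | inj₁ w[x]≡0 = record
    { Subbasis sb
    ; independent = Independent-∷ independent
    ; spanning    = λ j → InSpan-∷ (w[x]≡0 ∘ select) (w[x]≡0 j) (spanning j)
    }
    where
    sb = subbasis cs w
    open Subbasis sb
  subbasis (x ∷ cs) {suc p} w | inj₂ (π , w[π]x≢0) =
    Pivot.subbasis-extend w π x w[π]x≢0 (subbasis cs (Pivot.reduced w π x w[π]x≢0))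

  independent⇒≤length : ∀ cols {p} (w : Fin p → A → ℚ) → Independent cols w → p ≤ length cols
  independent⇒≤length [] {zero} w ind = z≤n
  independent⇒≤length [] {suc p} w ind with ind (λ _ → 1ℚ) (λ _ ()) zero
  ... | ()
  independent⇒≤length (x ∷ cs) w ind with zero-column-or-pivot w x
  ... | inj₁ w[x]≡0 = m≤n⇒m≤1+n (independent⇒≤length cs w (Independent-∷⁻ w[x]≡0 ind))
  independent⇒≤length (x ∷ cs) {suc p} w ind | inj₂ (π , w[π]x≢0) =
    s≤s (independent⇒≤length cs reduced (independent-reduced ind))
    where open Pivot w π x w[π]x≢0

  unit-columns⇒Independent : ∀ {cols p} (w : Fin p → A → ℚ) (col : Fin p → A) → (∀ b → col b ∈ cols) →
    (∀ b → w b (col b) ≡ 1ℚ) → (∀ a b → a ≢ b → w a (col b) ≡ 0ℚ) → Independent cols w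
  unit-columns⇒Independent {p = suc p} w col col∈ diagonal off-diagonal c vanish b = begin
    c b                                                  ≡⟨ solve 1 (λ t → t := t :* con 1ℚ :+ con 0ℚ) refl (c b) ⟩
    c b ℚ.* 1ℚ ℚ.+ 0ℚ                                    ≡⟨ cong₂ (λ s t → c b ℚ.* s ℚ.+ t) (diagonal b) others≡0 ⟨
    c b ℚ.* w b (col b) ℚ.+ lincomb (c ∘ punchIn b) (w ∘ punchIn b) (col b)
                                                         ≡⟨ sum-remove {i = b} (λ a → c a ℚ.* w a (col b)) ⟨
    lincomb c w (col b)                                  ≡⟨ vanish (col b) (col∈ b) ⟩
    0ℚ                                                   ∎
    where
    open ≡-Reasoning
    others≡0 : lincomb (c ∘ punchIn b) (w ∘ punchIn b) (col b) ≡ 0ℚ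
    others≡0 = lincomb-zeroʳ (c ∘ punchIn b) (w ∘ punchIn b) (col b) (λ j → off-diagonal _ b (punchInᵢ≢i b j))

independent-in-span⇒≤ : ∀ {A : Set} {cols : List A} {p u} {w : Fin p → A → ℚ} (v : Fin u → A → ℚ) →
                        Independent cols w → (∀ a → InSpan cols v (w a)) → p ≤ u
independent-in-span⇒≤ {p = p} {u} {w} v ind span =
  subst (p ≤_) (length-tabulate (λ i → i)) (independent⇒≤length (allFin u) C C-independent)
  where
  C : Fin p → Fin u → ℚ
  C a = proj₁ (span a)
  C-independent : Independent (allFin u) C
  C-independent μ vanish = ind μ λ J J∈ → begin
    lincomb μ w J
      ≡⟨ sum-cong-≗ (λ a → trans (cong (μ a ℚ.*_) (proj₂ (span a) J J∈)) (*-distribˡ-sum (μ a) (λ i → C a i ℚ.* v i J))) ⟩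
    ∑[ a < p ] ∑[ i < u ] (μ a ℚ.* (C a i ℚ.* v i J))
      ≡⟨ ∑-comm (λ a i → μ a ℚ.* (C a i ℚ.* v i J)) ⟩
    ∑[ i < u ] ∑[ a < p ] (μ a ℚ.* (C a i ℚ.* v i J))
      ≡⟨ sum-cong-≗ (λ i → trans (sum-cong-≗ (λ a → sym (ℚP.*-assoc (μ a) (C a i) (v i J))))
                                 (sym (*-distribʳ-sum (v i J) (λ a → μ a ℚ.* C a i)))) ⟩
    lincomb (λ i → lincomb μ C i) v J
      ≡⟨ lincomb-zeroˡ (λ i → lincomb μ C i) v J (λ i → vanish i (∈-allFin i)) ⟩
    0ℚ ∎
    where open ≡-Reasoning

-- The disjointness matrix

module _ (k' d' n' m : ℕ) where

  private
    N K L : ℕ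
    N = n' * m
    K = k' * m
    L = d' * m ∸ k' * m
    rows cols : List (Vec Bool N)
    rows = Rows k' d' n' m
    cols = Cols k' d' n' m
    Mₘ Bₘ : Vec Bool N → Vec Bool N → ℕ
    Mₘ = M k' d' n' m
    Bₘ = B k' d' n' m
    Mℚₘ : Vec Bool N → Vec Bool N → ℚ
    Mℚₘ = Mℚ k' d' n' m
    TrBₘ TrB²ₘ : ℕ
    TrBₘ = TrB k' d' n' m
    TrB²ₘ = TrB² k' d' n' m
    b : ℕ
    b = choose (N ∸ K) L

  row-sum : ∀ I → I ∈ rows → sumℕ cols (Mₘ I) ≡ b
  row-sum I I∈ = trans (count-disjoint I L) (cong (λ z → choose z L) (∈weightVecs⇒zeros≡ I∈))

  M²≡M : ∀ I J → Mₘ I J * Mₘ I J ≡ Mₘ I J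
  M²≡M I J with disjoint I J
  ... | true  = refl
  ... | false = refl

  TrB≡ : TrBₘ ≡ length rows * b
  TrB≡ = begin
    sumℕ cols (λ J → sumℕ rows (λ I → Mₘ I J * Mₘ I J))
      ≡⟨ sumℕ-comm cols rows _ ⟩
    sumℕ rows (λ I → sumℕ cols (λ J → Mₘ I J * Mₘ I J))
      ≡⟨ sumℕ-cong rows (λ I I∈ → trans (sumℕ-cong cols (λ J _ → M²≡M I J)) (row-sum I I∈)) ⟩
    sumℕ rows (λ _ → b)
      ≡⟨ sumℕ-const rows b ⟩
    length rows * b ∎
    where open ≡-Reasoning

  sum-B≡ : sumℕ cols (λ J → sumℕ cols (Bₘ J)) ≡ length rows * sq b
  sum-B≡ = begin
    sumℕ cols (λ J → sumℕ cols (λ J′ → sumℕ rows (λ I → Mₘ I J * Mₘ I J′)))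
      ≡⟨ sumℕ-cong cols (λ J _ → sumℕ-comm cols rows _) ⟩
    sumℕ cols (λ J → sumℕ rows (λ I → sumℕ cols (λ J′ → Mₘ I J * Mₘ I J′)))
      ≡⟨ sumℕ-comm cols rows _ ⟩
    sumℕ rows (λ I → sumℕ cols (λ J → sumℕ cols (λ J′ → Mₘ I J * Mₘ I J′)))
      ≡⟨ sumℕ-cong rows (λ I I∈ → trans (factor I) (cong sq (row-sum I I∈))) ⟩
    sumℕ rows (λ _ → sq b)
      ≡⟨ sumℕ-const rows (sq b) ⟩
    length rows * sq b ∎
    where
    open ≡-Reasoning
    factor : ∀ I → sumℕ cols (λ J → sumℕ cols (λ J′ → Mₘ I J * Mₘ I J′)) ≡ sq (sumℕ cols (Mₘ I))
    factor I = trans (sumℕ-cong cols (λ J _ → sumℕ-*ˡ cols (Mₘ I J) (Mₘ I))) (sumℕ-*ʳ cols _ (Mₘ I))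

  sq-sum-B≤ : sq (sumℕ cols (λ J → sumℕ cols (Bₘ J))) ≤ sq (length cols) * TrB²ₘ
  sq-sum-B≤ = subst (λ t → sq (sumℕ cols (λ J → sumℕ cols (Bₘ J))) ≤ sq (length cols) * t)
                    (sumℕ-cong cols (λ J _ → sumℕ-cong cols (λ J′ _ → cong (Bₘ J J′ *_) (B-symmetric J J′))))
                    (sq-double-sumℕ≤ cols Bₘ)
    where
    B-symmetric : ∀ J J′ → Bₘ J J′ ≡ Bₘ J′ J
    B-symmetric J J′ = sumℕ-cong rows (λ I _ → *-comm (Mₘ I J) (Mₘ I J′))

  rank-exists : Σ ℕ (RowSpaceDim k' d' n' m)
  rank-exists = size , List.lookup rows ∘ select , ∈-lookup ∘ select
    , (λ c vanish → independent c (λ J J∈ → trans (sym (sumFinℚ≡∑ size _)) (vanish J J∈)))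
    , λ I I∈ → let c , c-spans = spanning (Any.index I∈) in
        c , λ J J∈ → trans (cong (λ I′ → Mℚₘ I′ J) (lookup-index I∈))
                           (trans (c-spans J J∈) (sym (sumFinℚ≡∑ size _)))
    where open Subbasis (subbasis cols (Mℚₘ ∘ List.lookup rows))

  rank≥ : K + L ≤ N → ∀ {u} → RowSpaceDim k' d' n' m u → choose (K + L) K ≤ u
  rank≥ K+L≤N {u} (s , _ , _ , spans) =
    independent-in-span⇒≤ (Mℚₘ ∘ s) (unit-columns⇒Independent _ col col∈ diagonal off-diagonal) row-in-span
    where
    open IdentitySubmatrix {K} {L} K+L≤N
    diagonal : ∀ a → Mℚₘ (row a) (col a) ≡ 1ℚ
    diagonal a = cong (λ t → if t then 1ℚ else 0ℚ) (disjoint-row-col a)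
    off-diagonal : ∀ a a′ → a ≢ a′ → Mℚₘ (row a) (col a′) ≡ 0ℚ
    off-diagonal a a′ a≢a′ with disjoint (row a) (col a′) in eq
    ... | true  = ⊥-elim (a≢a′ (disjoint-row-col⇒≡ a a′ eq))
    ... | false = refl
    row-in-span : ∀ a → InSpan cols (Mℚₘ ∘ s) (Mℚₘ (row a))
    row-in-span a = let c , c-spans = spans (row a) (row∈ a) in
      c , λ J J∈ → trans (c-spans J J∈) (sumFinℚ≡∑ u _)

  trace-ratio-bound : ∀ q → 1 ≤ K → 4 * suc q ≤ L → 2 * (K + L) ≤ N →
    Σ ℕ λ u → RowSpaceDim k' d' n' m u × suc q * (TrBₘ ^ 2) ≤ u * TrB²ₘ
  trace-ratio-bound q 1≤K 4[q+1]≤L 2[K+L]≤N = u , dim , *-cancelˡ-≤ (sq T) {{T²≢0}} (begin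
    sq T * (suc q * (TrBₘ ^ 2))            ≡⟨ cong (λ t → sq T * (suc q * t)) TrB^2≡ ⟩
    sq T * (suc q * sq X)                  ≡⟨ x∙yz≈y∙xz (sq T) (suc q) (sq X) ⟩
    suc q * (sq T * sq X)                  ≡⟨ *-assoc (suc q) (sq T) (sq X) ⟨
    (suc q * sq T) * sq X                  ≤⟨ *-monoˡ-≤ (sq X) (≤-trans numeric (*-monoˡ-≤ (sq b) (rank≥ K+L≤N dim))) ⟩
    (u * sq b) * sq X                      ≡⟨ regroup u b X ⟩
    u * sq (X * b)                         ≡⟨ cong (λ t → u * sq t) (trans (*-assoc (length rows) b b) (sym sum-B≡)) ⟩
    u * sq (sumℕ cols (λ J → sumℕ cols (Bₘ J)))
                                           ≤⟨ *-monoʳ-≤ u sq-sum-B≤ ⟩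
    u * (sq T * TrB²ₘ)           ≡⟨ x∙yz≈y∙xz u (sq T) _ ⟩
    sq T * (u * TrB²ₘ)           ∎)
    where
    open ≤-Reasoning
    u = proj₁ rank-exists
    dim = proj₂ rank-exists
    T = length cols
    X = length rows * b
    K+L≤N : K + L ≤ N
    K+L≤N = ≤-trans (m≤m+n (K + L) _) 2[K+L]≤N
    T≢0 : NonZero T
    T≢0 = >-nonZero (choose-pos (≤-trans (m≤n+m L K) K+L≤N))
    T²≢0 : NonZero (sq T)
    T²≢0 = m*n≢0 T T {{T≢0}} {{T≢0}}
    TrB^2≡ : TrBₘ ^ 2 ≡ sq X
    TrB^2≡ = trans (cong (TrBₘ *_) (*-identityʳ _)) (cong sq TrB≡)
    numeric : suc q * sq T ≤ choose (K + L) K * sq b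
    numeric = choose-sq-bound′ q N K L 1≤K 4[q+1]≤L 2[K+L]≤N
    regroup : ∀ u b X → u * (b * b) * (X * X) ≡ u * ((X * b) * (X * b))
    regroup = solve-∀

proposition2 : (k' d' n' : ℕ) → 1 ≤ k' → k' < d' → 2 * d' < n' →
    (q : ℕ) → Σ ℕ λ N → (m : ℕ) → N ≤ m →
    Σ ℕ λ u → RowSpaceDim k' d' n' m u ×
    suc q * (TrB k' d' n' m ^ 2) ≤ u * TrB² k' d' n' m
proposition2 k' d' n' 1≤k' k'<d' 2d'<n' q = 4 * suc q , λ m 4[q+1]≤m →
  trace-ratio-bound k' d' n' m q
    (*-mono-≤ 1≤k' (≤-trans (s≤s z≤n) 4[q+1]≤m))
    (≤-trans 4[q+1]≤m (m≤L m))
    (2[K+L]≤N m)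
  where
  open ≤-Reasoning
  m≤L : ∀ m → m ≤ d' * m ∸ k' * m
  m≤L m = begin
    m                 ≡⟨ *-identityˡ m ⟨
    1 * m             ≤⟨ *-monoˡ-≤ m (m<n⇒0<n∸m k'<d') ⟩
    (d' ∸ k') * m     ≡⟨ *-distribʳ-∸ m d' k' ⟩
    d' * m ∸ k' * m   ∎
  2[K+L]≤N : ∀ m → 2 * (k' * m + (d' * m ∸ k' * m)) ≤ n' * m
  2[K+L]≤N m = begin
    2 * (k' * m + (d' * m ∸ k' * m))  ≡⟨ cong (2 *_) (m+[n∸m]≡n (*-monoˡ-≤ m (<⇒≤ k'<d'))) ⟩
    2 * (d' * m)                      ≡⟨ *-assoc 2 d' m ⟨
    2 * d' * m                        ≤⟨ *-monoˡ-≤ m (<⇒≤ 2d'<n') ⟩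
    n' * m                            ∎
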